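{- Let $I=(E,\mathcal{I},c,T)$ be an EMB instance and let $P=(\mathrm{opt},\mathcal{F},\triangleleft)\in\mathcal{Q}$ with $\mathrm{opt}=\max$. Then every solution $S$ of $R_P(I)$ satisfies $v_I(S)\le k_I\cdot H_I+T$.
   Context: A matroid is a pair $(E,\mathcal{I})$ with $E$ finite, $\emptyset\in\mathcal{I}\subseteq2^E$, closed under subsets, with the exchange property; for $\mathcal{M}=(E,\mathcal{I})$, $\mathrm{IS}(\mathcal{M})=\mathcal{I}$ and $\mathrm{bases}(\mathcal{M})$ is the set of independent sets of maximum cardinality. For a function $f$ on $E$ and $Y\subseteq E$, $f(Y)=\sum_{e\in Y}f(e)$. EMB instance: $(E,\mathcal{I},c,T)$ with $(E,\mathcal{I})$ a matroid, $c:E\to\mathbb{N}$, $T\in\mathbb{N}$. $\mathcal{Q}=\left(\{\max,\min\}\times\{\mathrm{bases},\mathrm{IS}\}\times\{\le,\ge\}\right)\setminus\{(\min,\mathrm{IS},\le)\}$. For $P=(\mathrm{opt},\mathcal{F},\triangleleft)$, a $P$-MOL instance $(E,\mathcal{I},v,w,L)$ (matroid $\mathcal{M}=(E,\mathcal{I})$, $v,w:E\to\mathbb{R}_{\ge0}$, $L\ge0$) has as solutions the sets $S\in\mathcal{F}(\mathcal{M})$ with $w(S)\triangleleft L$. Reduction: $d(P)=0$ if ($\mathrm{opt}=\max$ and $\triangleleft$ is $\le$) or ($\mathrm{opt}=\min$ and $\triangleleft$ is $\ge$), else $d(P)=1$; $H_I=2\max\{1,c(E)\}$; $v_I(e)=H_I+c(e)$;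 $w_{I,P}(e)=H_I+c(e)(-1)^{d(P)}$; $k_I=\max_{S\in\mathcal{I}}|S|$; $L_{I,P}=k_IH_I+T(-1)^{d(P)}$; $R_P(I)=(E,\mathcal{I},v_I,w_{I,P},L_{I,P})$. -}

module Defs where

open import Data.Nat as ℕ using (ℕ; zero; suc)
open import Data.Bool using (Bool; true; false; if_then_else_)
open import Data.Fin using (Fin)
import Data.Fin as Fin
open import Data.Fin.Subset using (Subset; ⊥; ⊤; _⊆_; _∈_; _∉_; _∪_; ⁅_⁆; ∣_∣)
open import Data.Vec using ([]; _∷_)
open import Data.Integer as ℤ using (ℤ; +_; -_; _+_; _*_; _^_; _⊔_)
open import Data.Product using (_×_; ∃-syntax)
open import Relation.Binary.PropositionalEquality using (_≡_)

record Matroid (n : ℕ) : Set₁ where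
  field
    Indep    : Subset n → Set
    indep-∅  : Indep ⊥
    indep-⊆  : ∀ {A B} → A ⊆ B → Indep B → Indep A
    exchange : ∀ {A B} → Indep A → Indep B → ∣ A ∣ ℕ.< ∣ B ∣ →
               ∃[ e ] (e ∈ B × e ∉ A × Indep (A ∪ ⁅ e ⁆))
open Matroid public

IS : ∀ {n} → Matroid n → Subset n → Set
IS M S = Indep M S

bases : ∀ {n} → Matroid n → Subset n → Set
bases M S = Indep M S × (∀ S′ → Indep M S′ → ∣ S′ ∣ ℕ.≤ ∣ S ∣)

IsMaxIndepCard : ∀ {n} → Matroid n → ℕ → Set
IsMaxIndepCard M k = (∃[ S ] (Indep M S × ∣ S ∣ ≡ k)) × (∀ S → Indep M S → ∣ S ∣ ℕ.≤ k)

sumOver : ∀ {n} → (Fin n → ℤ) → Subset n → ℤ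
sumOver {zero}  f []      = + 0
sumOver {suc n} f (b ∷ p) = (if b then f Fin.zero else + 0) + sumOver (λ i → f (Fin.suc i)) p

record EMB (n : ℕ) : Set₁ where
  field
    mat : Matroid n
    c   : Fin n → ℕ
    T   : ℕ
open EMB public

data Opt : Set where
  max min : Opt

data Fam : Set where
  basesF ISF : Fam

data Rel : Set where
  le ge : Rel

record Problem : Set where
  constructor ⟨_,_,_⟩
  field
    opt : Opt
    fam : Fam
    rel : Rel
open Problem public

-- Q = ({max,min} × {bases,IS} × {≤,≥}) \ {(min,IS,≤)}
data InQ : Problem → Set where
  inQ-max : ∀ F r → InQ ⟨ max , F , r ⟩
  inQ-minB : ∀ r → InQ ⟨ min , basesF , r ⟩
  inQ-minIS : InQ ⟨ min , ISF , ge ⟩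

famOf : ∀ {n} → Fam → Matroid n → Subset n → Set
famOf basesF M = bases M
famOf ISF    M = IS M

relOf : Rel → ℤ → ℤ → Set
relOf le x y = x ℤ.≤ y
relOf ge x y = x ℤ.≥ y

-- MOL instances (E, I, v, w, L); values are integers here

record MOL (n : ℕ) : Set₁ where
  field
    matM : Matroid n
    v w  : Fin n → ℤ
    L    : ℤ
open MOL public

Solution : ∀ {n} → Problem → MOL n → Subset n → Set
Solution P J S = famOf (fam P) (matM J) S × relOf (rel P) (sumOver (w J) S) (L J)

d : Problem → ℕ
d ⟨ max , _ , le ⟩ = 0
d ⟨ min , _ , ge ⟩ = 0
d ⟨ max , _ , ge ⟩ = 1
d ⟨ min , _ , le ⟩ = 1

cE : ∀ {n} → EMB n → ℤ
cE I = sumOver (λ e → + c I e) ⊤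

H : ∀ {n} → EMB n → ℤ
H I = + 2 * (+ 1 ⊔ cE I)

vI : ∀ {n} → EMB n → Fin n → ℤ
vI I e = H I + + c I e

wIP : ∀ {n} → EMB n → Problem → Fin n → ℤ
wIP I P e = H I + + c I e * (- + 1) ^ d P

-- L_{I,P}, given k = k_I
LIP : ∀ {n} → EMB n → Problem → ℕ → ℤ
LIP I P k = + k * H I + + T I * (- + 1) ^ d P

-- R_P(I), given k = k_I
R : ∀ {n} → Problem → EMB n → ℕ → MOL n
R P I k = record { matM = mat I ; v = vI I ; w = wIP I P ; L = LIP I P k }

-- Adding H > c(E) to every element makes cardinality dominate. For ◁ = ≤ (d = 0) we have
-- w = v and L = kH + T. For ◁ = ≥ (d = 1) a solution has |S|H − c(S) ≥ kH − T with |S| ≤ k: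
-- if |S| < k then v(S) = |S|H + c(S) < (|S| + 1)H ≤ kH, and if |S| = k the constraint reads
-- c(S) ≤ T.
module Submission where

open import Defs
open import Data.Nat using (ℕ)
open import Data.Fin.Subset using (Subset)
open import Data.Integer using (+_; _+_; _*_; _≤_)
open import Relation.Binary.PropositionalEquality using (_≡_)

import Data.Nat as ℕ
open import Data.Nat.Properties using (m≤n⇒m<n∨m≡n)
open import Data.Integer using (ℤ; 0ℤ; 1ℤ; -1ℤ; -_; _-_; _^_; _<_; _⊔_; +≤+; +<+; nonNegative)
open import Data.Integer.Properties
open import Algebra.Properties.CommutativeSemigroup +-commutativeSemigroup using (interchange)
open import Data.Bool using (true; false)
open import Data.Fin using (Fin)
import Data.Fin as Fin
open import Data.Fin.Subset using (⊤; ∣_∣)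
open import Data.Vec using ([]; _∷_)
open import Data.Product using (_,_; proj₁)
open import Data.Sum using (inj₁; inj₂)
open import Function using (_∘_)
open import Relation.Binary.PropositionalEquality using (refl; sym; trans; cong; cong₂; subst₂)

sumOver-+ : ∀ {n} (f g : Fin n → ℤ) (S : Subset n) →
            sumOver (λ e → f e + g e) S ≡ sumOver f S + sumOver g S
sumOver-+ f g [] = refl
sumOver-+ f g (true ∷ S) =
  trans (cong (_+_ (f Fin.zero + g Fin.zero)) (sumOver-+ (f ∘ Fin.suc) (g ∘ Fin.suc) S))
        (interchange (f Fin.zero) (g Fin.zero) _ _)
sumOver-+ f g (false ∷ S) =
  trans (+-identityˡ (sumOver (λ e → f (Fin.suc e) + g (Fin.suc e)) S))
  (trans (sumOver-+ (f ∘ Fin.suc) (g ∘ Fin.suc) S)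
         (sym (cong₂ _+_ (+-identityˡ (sumOver (f ∘ Fin.suc) S))
                         (+-identityˡ (sumOver (g ∘ Fin.suc) S)))))

sumOver-*ʳ : ∀ {n} (f : Fin n → ℤ) (a : ℤ) (S : Subset n) →
             sumOver (λ e → f e * a) S ≡ sumOver f S * a
sumOver-*ʳ f a [] = refl
sumOver-*ʳ f a (true ∷ S) =
  trans (cong (_+_ (f Fin.zero * a)) (sumOver-*ʳ (f ∘ Fin.suc) a S))
        (sym (*-distribʳ-+ a (f Fin.zero) _))
sumOver-*ʳ f a (false ∷ S) =
  trans (+-identityˡ (sumOver (λ e → f (Fin.suc e) * a) S))
  (trans (sumOver-*ʳ (f ∘ Fin.suc) a S) (cong (_* a) (sym (+-identityˡ (sumOver (f ∘ Fin.suc) S)))))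

sumOver-const : ∀ {n} (a : ℤ) (S : Subset n) → sumOver (λ _ → a) S ≡ + ∣ S ∣ * a
sumOver-const a [] = refl
sumOver-const a (true ∷ S) = trans (cong (_+_ a) (sumOver-const a S)) (sym (suc-* (+ ∣ S ∣) a))
sumOver-const a (false ∷ S) = trans (+-identityˡ (sumOver (λ _ → a) S)) (sumOver-const a S)

sumOver-nonNeg : ∀ {n} {f : Fin n → ℤ} → (∀ e → 0ℤ ≤ f e) → (S : Subset n) → 0ℤ ≤ sumOver f S
sumOver-nonNeg f≥0 [] = ≤-refl
sumOver-nonNeg f≥0 (true ∷ S) = +-mono-≤ (f≥0 Fin.zero) (sumOver-nonNeg (f≥0 ∘ Fin.suc) S)
sumOver-nonNeg f≥0 (false ∷ S) = +-mono-≤ (≤-refl {0ℤ}) (sumOver-nonNeg (f≥0 ∘ Fin.suc) S)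

sumOver-≤-⊤ : ∀ {n} {f : Fin n → ℤ} → (∀ e → 0ℤ ≤ f e) → (S : Subset n) → sumOver f S ≤ sumOver f ⊤
sumOver-≤-⊤ f≥0 [] = ≤-refl
sumOver-≤-⊤ {f = f} f≥0 (true ∷ S) = +-monoʳ-≤ (f Fin.zero) (sumOver-≤-⊤ (f≥0 ∘ Fin.suc) S)
sumOver-≤-⊤ f≥0 (false ∷ S) = +-mono-≤ (f≥0 Fin.zero) (sumOver-≤-⊤ (f≥0 ∘ Fin.suc) S)

+-cancelˡ-≤ : ∀ i {j k} → i + j ≤ i + k → j ≤ k
+-cancelˡ-≤ i {j} {k} i+j≤i+k = subst₂ _≤_ (-i+[i+j]≡j j) (-i+[i+j]≡j k) (+-monoʳ-≤ (- i) i+j≤i+k)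
  where
  -i+[i+j]≡j : ∀ j → - i + (i + j) ≡ j
  -i+[i+j]≡j j = trans (sym (+-assoc (- i) i j)) (trans (cong (_+ j) (+-inverseˡ i)) (+-identityˡ j))

i*-1≡-i : ∀ i → i * -1ℤ ≡ - i
i*-1≡-i i = trans (*-comm i -1ℤ) (-1*i≡-i i)

i<2*[1⊔i] : ∀ i → i < + 2 * (+ 1 ⊔ i)
i<2*[1⊔i] i = begin-strict
  i                     ≡⟨ +-identityʳ i ⟨
  i + 0ℤ                <⟨ +-mono-≤-< (i≤j⊔i (+ 1) i) (<-≤-trans (+<+ ℕ.z<s) (i≤i⊔j (+ 1) i)) ⟩
  m + m                 ≡⟨ cong (_+_ m) (*-identityˡ m) ⟨
  m + + 1 * m           ≡⟨ suc-* (+ 1) m ⟨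
  + 2 * m               ∎
  where
  open ≤-Reasoning
  m = + 1 ⊔ i

k*h-t≤s*h-x⇒s*h+x≤k*h+t : ∀ {s k : ℕ} {h x : ℤ} (t : ℕ) → s ℕ.≤ k → 0ℤ ≤ x → x < h →
                          + k * h - + t ≤ + s * h - x → + s * h + x ≤ + k * h + + t
k*h-t≤s*h-x⇒s*h+x≤k*h+t {s} {k} {h} {x} t s≤k 0≤x x<h k*h-t≤s*h-x with m≤n⇒m<n∨m≡n s≤k
... | inj₂ refl = +-monoʳ-≤ (+ s * h) (neg-cancel-≤ (+-cancelˡ-≤ (+ s * h) k*h-t≤s*h-x))
... | inj₁ s<k = begin
  + s * h + x      <⟨ +-monoʳ-< (+ s * h) x<h ⟩
  + s * h + h      ≡⟨ +-comm (+ s * h) h ⟩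
  h + + s * h      ≡⟨ suc-* (+ s) h ⟨
  + ℕ.suc s * h    ≤⟨ *-monoʳ-≤-nonNeg h {{nonNegative (≤-trans 0≤x (<⇒≤ x<h))}} (+≤+ s<k) ⟩
  + k * h          ≤⟨ i≤i+j (+ k * h) (+ t) ⟩
  + k * h + + t    ∎
  where open ≤-Reasoning

famOf⇒Indep : ∀ {n} F {M : Matroid n} {S : Subset n} → famOf F M S → Indep M S
famOf⇒Indep basesF = proj₁
famOf⇒Indep ISF S∈IS = S∈IS

cSum : ∀ {n} → EMB n → Subset n → ℤ
cSum I = sumOver (λ e → + c I e)

sumOver-vI : ∀ {n} (I : EMB n) (S : Subset n) → sumOver (vI I) S ≡ + ∣ S ∣ * H I + cSum I S
sumOver-vI I S =
  trans (sumOver-+ (λ _ → H I) (λ e → + c I e) S) (cong (_+ cSum I S) (sumOver-const (H I) S))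

sumOver-wIP : ∀ {n} (I : EMB n) (P : Problem) (S : Subset n) →
              sumOver (wIP I P) S ≡ + ∣ S ∣ * H I + cSum I S * (- + 1) ^ d P
sumOver-wIP I P S =
  trans (sumOver-+ (λ _ → H I) (λ e → + c I e * (- + 1) ^ d P) S)
        (cong₂ _+_ (sumOver-const (H I) S) (sumOver-*ʳ (λ e → + c I e) ((- + 1) ^ d P) S))

cSum<H : ∀ {n} (I : EMB n) (S : Subset n) → cSum I S < H I
cSum<H I S = ≤-<-trans (sumOver-≤-⊤ (λ _ → +≤+ ℕ.z≤n) S) (i<2*[1⊔i] (cE I))

lemma3p5 : ∀ {n} (I : EMB n) (P : Problem) → InQ P → opt P ≡ max →
           (k : ℕ) → IsMaxIndepCard (mat I) k →
           (S : Subset n) → Solution P (R P I k) S →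
           sumOver (vI I) S ≤ + k * H I + + T I
lemma3p5 I ⟨ max , F , r ⟩ _ refl k (_ , k-max) S (S∈F , S-feasible) = bound r S-feasible
  where
  open ≤-Reasoning
  |S|≤k : ∣ S ∣ ℕ.≤ k
  |S|≤k = k-max S (famOf⇒Indep F S∈F)
  bound : ∀ r → relOf r (sumOver (wIP I ⟨ max , F , r ⟩) S) (LIP I ⟨ max , F , r ⟩ k) →
          sumOver (vI I) S ≤ + k * H I + + T I
  -- Once r is known, (- + 1) ^ d P computes to 1ℤ or -1ℤ.
  bound le w≤L = begin
    sumOver (vI I) S                     ≡⟨ sumOver-vI I S ⟩
    + ∣ S ∣ * H I + cSum I S             ≡⟨ cong (_+_ (+ ∣ S ∣ * H I)) (*-identityʳ (cSum I S)) ⟨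
    + ∣ S ∣ * H I + cSum I S * 1ℤ        ≡⟨ sumOver-wIP I (⟨ max , F , le ⟩) S ⟨
    sumOver (wIP I (⟨ max , F , le ⟩)) S ≤⟨ w≤L ⟩
    + k * H I + + T I * 1ℤ               ≡⟨ cong (_+_ (+ k * H I)) (*-identityʳ (+ T I)) ⟩
    + k * H I + + T I                    ∎
  bound ge L≤w = begin
    sumOver (vI I) S                     ≡⟨ sumOver-vI I S ⟩
    + ∣ S ∣ * H I + cSum I S             ≤⟨ k*h-t≤s*h-x⇒s*h+x≤k*h+t (T I) |S|≤k
                                              (sumOver-nonNeg (λ _ → +≤+ ℕ.z≤n) S) (cSum<H I S) L≤w′ ⟩
    + k * H I + + T I                    ∎
    where
    L≤w′ : + k * H I - + T I ≤ + ∣ S ∣ * H I - cSum I S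
    L≤w′ = subst₂ _≤_ (cong (_+_ (+ k * H I)) (i*-1≡-i (+ T I)))
                      (trans (sumOver-wIP I ⟨ max , F , ge ⟩ S)
                             (cong (_+_ (+ ∣ S ∣ * H I)) (i*-1≡-i (cSum I S))))
                      L≤w
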